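{- Let $G$ be a graph with $m$ vertices and $H$ an $r$-regular graph with $n$ vertices. Let $p$ be a prime with $n\equiv 0\pmod p$. If $\Gamma$ is an Abelian group with $p^2$ elements, then the composition $G[H]$ is $\Gamma$-vertex magic.
   Context: Graphs are finite, simple and undirected. For an additive Abelian group $\Gamma$ with identity $0$ and a graph $G$, a $\Gamma$-vertex magic labeling is a map $\ell:V(G)\to\Gamma\setminus\{0\}$ for which there is $\mu\in\Gamma$ with $w(v)=\sum_{u\in N(v)}\ell(u)=\mu$ for every vertex $v$; $G$ is $\Gamma$-vertex magic if it has such a labeling. The composition (lexicographic product) $G[H]$ has vertex set $V(G)\times V(H)$, with $(g,h)\sim(g',h')$ iff $g\sim g'$ in $G$, or $g=g'$ and $h\sim h'$ in $H$. -}

module Defs where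

open import Level using (Level; 0ℓ)
open import Data.Bool using (Bool; true; false; _∧_; _∨_)
open import Data.Nat using (ℕ; zero; suc; _*_; _+_)
open import Data.Fin using (Fin; zero; suc; remQuot)
open import Data.Fin.Properties using (_≟_)
open import Data.Product using (_×_; _,_; ∃)
open import Relation.Nullary using (¬_)
open import Relation.Nullary.Decidable using (⌊_⌋)
open import Relation.Binary.PropositionalEquality using (_≡_)
open import Algebra.Bundles using (AbelianGroup)

Adj : ℕ → Set
Adj n = Fin n → Fin n → Bool

IsSimpleGraph : ∀ {n} → Adj n → Set
IsSimpleGraph {n} A = (∀ (u v : Fin n) → A u v ≡ A v u) × (∀ (v : Fin n) → A v v ≡ false)

sumℕ : ∀ {n} → (Fin n → ℕ) → ℕ
sumℕ {zero} f = 0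
sumℕ {suc n} f = f zero + sumℕ (λ i → f (suc i))

boolToℕ : Bool → ℕ
boolToℕ true = 1
boolToℕ false = 0

degree : ∀ {n} → Adj n → Fin n → ℕ
degree A v = sumℕ (λ u → boolToℕ (A v u))

IsRegular : ∀ {n} → Adj n → ℕ → Set
IsRegular {n} A r = ∀ (v : Fin n) → degree A v ≡ r

-- Composition (lexicographic product) G[H] on vertex set Fin m × Fin n,
-- encoded as Fin (m * n) via the standard bijection remQuot / combine.
compose : ∀ {m n} → Adj m → Adj n → Adj (m * n)
compose {m} {n} G H i j with remQuot {m} n i | remQuot {m} n j
... | g , h | g' , h' = G g g' ∨ (⌊ g ≟ g' ⌋ ∧ H h h')

module _ {c ℓ : Level} (Γ : AbelianGroup c ℓ) where
  open AbelianGroup Γ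

  sumΓ : ∀ {n} → (Fin n → Carrier) → Carrier
  sumΓ {zero} f = ε
  sumΓ {suc n} f = f zero ∙ sumΓ (λ i → f (suc i))

  weight : ∀ {n} → Adj n → (Fin n → Carrier) → Fin n → Carrier
  weight A lab v = sumΓ (λ u → if A v u then lab u else ε)
    where
    if_then_else_ : Bool → Carrier → Carrier → Carrier
    if true then x else y = x
    if false then x else y = y

  IsVertexMagicLabeling : ∀ {n} → Adj n → (Fin n → Carrier) → Set (c Level.⊔ ℓ)
  IsVertexMagicLabeling {n} A lab =
    (∀ (v : Fin n) → ¬ (lab v ≈ ε)) × ∃ (λ μ → ∀ (v : Fin n) → weight A lab v ≈ μ)

  IsVertexMagic : ∀ {n} → Adj n → Set (c Level.⊔ ℓ)
  IsVertexMagic {n} A = ∃ (λ (lab : Fin n → Carrier) → IsVertexMagicLabeling A lab)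

-- The labeling that is constant at a ≠ 0 has weight deg(v) · a at every vertex v.
-- In G[H] the vertex (g , h) has degree n · deg_G(g) + deg_H(h), so if n · a = 0
-- every weight equals r · a.  Such an a exists: Γ has p² elements, so p² · x = 0
-- for all x; for any x ≠ 0 either p · x = 0 already or p · x is a nonzero element
-- killed by p, and p ∣ n then gives n · a = 0.
module Submission where

open import Defs
open import Level using (Level)
open import Data.Nat using (ℕ; _*_)
open import Data.Nat.Divisibility using (_∣_)
open import Data.Nat.Primality using (Prime)
open import Data.Fin using (Fin)
open import Data.Product using (_×_)
open import Relation.Binary.PropositionalEquality using (_≡_; setoid)
open import Algebra.Bundles using (AbelianGroup)
open import Function.Bundles using (Bijection)

open import Data.Nat using (zero; suc; _+_; _<_; z≤n; s≤s; nonTrivial⇒n>1)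
import Data.Nat.Properties as ℕ
open import Data.Nat.Divisibility using (divides; n∣m*n)
open import Data.Nat.Primality using (prime⇒nonTrivial)
open import Data.Fin using (zero; suc; _↑ˡ_; _↑ʳ_; combine; remQuot)
open import Data.Fin.Properties using (_≟_; remQuot-combine)
open import Data.Fin.Permutation using (Permutation′; permutation)
open import Data.Bool using (Bool; true; false; _∧_; _∨_)
open import Data.Product using (_,_; proj₁; proj₂; ∃)
open import Function using (_∘_)
open import Function.Bundles using (Inverse)
open import Function.Properties.Bijection using (Bijection⇒Inverse)
open import Function.Properties.Inverse using (Inverse⇒Injection)
import Function.Construct.Symmetry as Symmetry
open import Relation.Nullary using (¬_; Dec; yes; no; contradiction)
open import Relation.Nullary.Decidable using (⌊_⌋; ⌊⌋-map′; via-injection)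
open import Relation.Binary.Definitions using (Decidable)
import Relation.Binary.PropositionalEquality as ≡
open import Algebra.Bundles using (Monoid)

module _ {a ℓ} (M : Monoid a ℓ) where
  open Monoid M
  open import Algebra.Properties.Monoid.Sum M using (sum)
  open import Algebra.Definitions.RawMonoid rawMonoid using () renaming (_×_ to _·_)
  open import Algebra.Properties.Monoid.Mult M using (×-assocˡ; ×-congʳ)
  open import Relation.Binary.Reasoning.Setoid (Monoid.setoid M)

  sum-↑ : ∀ m {n} (f : Fin (m + n) → Carrier) →
          sum f ≈ sum (λ i → f (i ↑ˡ n)) ∙ sum (λ j → f (m ↑ʳ j))
  sum-↑ zero    f = sym (identityˡ _)
  sum-↑ (suc m) f = trans (∙-congˡ (sum-↑ m (f ∘ suc))) (sym (assoc _ _ _))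

  sum-combine : ∀ m {n} (f : Fin (m * n) → Carrier) →
                sum f ≈ sum {m} (λ i → sum {n} (λ j → f (combine i j)))
  sum-combine zero    f = refl
  sum-combine (suc m) {n} f = trans (sum-↑ n f) (∙-congˡ (sum-combine m (λ k → f (n ↑ʳ k))))

  ×-ε : ∀ k → k · ε ≈ ε
  ×-ε zero    = refl
  ×-ε (suc k) = trans (identityˡ _) (×-ε k)

  ∣-×≈ε : ∀ {n k} x → n ∣ k → n · x ≈ ε → k · x ≈ ε
  ∣-×≈ε {n} x (divides q ≡.refl) n·x≈ε = begin
    (q * n) · x  ≈⟨ ×-assocˡ x q n ⟨
    q · (n · x)  ≈⟨ ×-congʳ q n·x≈ε ⟩
    q · ε        ≈⟨ ×-ε q ⟩
    ε            ∎

  nontrivial-torsion : ∀ p {x} → Dec (p · x ≈ ε) → ¬ x ≈ ε → (p * p) · x ≈ ε →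
                       ∃ λ y → ¬ y ≈ ε × p · y ≈ ε
  nontrivial-torsion p {x} (yes p·x≈ε) x≉ε _       = x , x≉ε , p·x≈ε
  nontrivial-torsion p {x} (no p·x≉ε)  _   p²·x≈ε = p · x , p·x≉ε , trans (×-assocˡ x p p) p²·x≈ε

module _ where
  open import Algebra.Properties.Semiring.Sum ℕ.+-*-semiring
    using (sum; sum-cong-≗; ∑-distrib-+; *-distribʳ-sum)

  sumℕ≡sum : ∀ {n} (f : Fin n → ℕ) → sumℕ f ≡ sum f
  sumℕ≡sum {zero}  f = ≡.refl
  sumℕ≡sum {suc n} f = ≡.cong (f zero +_) (sumℕ≡sum (f ∘ suc))

  sum-const : ∀ n k → sum {n} (λ _ → k) ≡ n * k
  sum-const zero    k = ≡.refl
  sum-const (suc n) k = ≡.cong (k +_) (sum-const n k)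

  sum-indicator : ∀ {m} (g : Fin m) d → sum (λ g′ → boolToℕ ⌊ g ≟ g′ ⌋ * d) ≡ d
  sum-indicator {suc m} zero d = begin
    d + 0 + sum {m} (λ _ → 0)  ≡⟨ ≡.cong (d + 0 +_) (≡.trans (sum-const m 0) (ℕ.*-zeroʳ m)) ⟩
    d + 0 + 0                  ≡⟨ ℕ.+-identityʳ (d + 0) ⟩
    d + 0                      ≡⟨ ℕ.+-identityʳ d ⟩
    d                          ∎
    where open ≡.≡-Reasoning
  sum-indicator {suc m} (suc g) d =
    ≡.trans (sum-cong-≗ (λ g′ → ≡.cong (λ b → boolToℕ b * d) (⌊⌋-map′ _ _ (g ≟ g′)))) (sum-indicator g d)

  count-∨-∧ : ∀ {n} x y (b : Fin n → Bool) → x ∧ y ≡ false →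
              sum (λ i → boolToℕ (x ∨ (y ∧ b i))) ≡ boolToℕ x * n + boolToℕ y * sum (boolToℕ ∘ b)
  count-∨-∧ {n} true  false b _ = ≡.trans (sum-const n 1) (≡.trans (ℕ.*-comm n 1) (≡.sym (ℕ.+-identityʳ _)))
  count-∨-∧ {n} false true  b _ = ≡.sym (ℕ.*-identityˡ _)
  count-∨-∧ {n} false false b _ = ≡.trans (sum-const n 0) (ℕ.*-zeroʳ n)

  compose-combine : ∀ {m n} (G : Adj m) (H : Adj n) v g′ h′ →
                    let (g , h) = remQuot {m} n v in
                    compose G H v (combine g′ h′) ≡ G g g′ ∨ (⌊ g ≟ g′ ⌋ ∧ H h h′)
  compose-combine {m} {n} G H v g′ h′ =
    ≡.cong (λ (x , y) → G g x ∨ (⌊ g ≟ x ⌋ ∧ H h y)) (remQuot-combine g′ h′)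
    where
    g : Fin m
    g = proj₁ (remQuot {m} n v)
    h : Fin n
    h = proj₂ (remQuot {m} n v)

  degree-compose : ∀ {m n} (G : Adj m) (H : Adj n) → (∀ g → G g g ≡ false) → ∀ v →
                   let (g , h) = remQuot {m} n v in
                   degree (compose G H) v ≡ degree G g * n + degree H h
  degree-compose {m} {n} G H loopless v = begin
    degree (compose G H) v
      ≡⟨ sumℕ≡sum (boolToℕ ∘ compose G H v) ⟩
    sum (λ u → boolToℕ (compose G H v u))
      ≡⟨ sum-combine ℕ.+-0-monoid m _ ⟩
    sum {m} (λ g′ → sum {n} (λ h′ → boolToℕ (compose G H v (combine g′ h′))))
      ≡⟨ sum-cong-≗ {m} row-count ⟩
    sum (λ g′ → boolToℕ (G g g′) * n + boolToℕ ⌊ g ≟ g′ ⌋ * degree H h)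
      ≡⟨ ∑-distrib-+ (λ g′ → boolToℕ (G g g′) * n) _ ⟩
    sum (λ g′ → boolToℕ (G g g′) * n) + sum (λ g′ → boolToℕ ⌊ g ≟ g′ ⌋ * degree H h)
      ≡⟨ ≡.cong₂ _+_ (≡.sym (*-distribʳ-sum n (boolToℕ ∘ G g))) (sum-indicator g (degree H h)) ⟩
    sum (boolToℕ ∘ G g) * n + degree H h
      ≡⟨ ≡.cong (λ d → d * n + degree H h) (sumℕ≡sum (boolToℕ ∘ G g)) ⟨
    degree G g * n + degree H h
      ∎
    where
    open ≡.≡-Reasoning
    g : Fin m
    g = proj₁ (remQuot {m} n v)
    h : Fin n
    h = proj₂ (remQuot {m} n v)

    disjoint : ∀ g′ → G g g′ ∧ ⌊ g ≟ g′ ⌋ ≡ false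
    disjoint g′ with G g g′ in e | g ≟ g′
    ... | true  | yes ≡.refl = contradiction (≡.trans (≡.sym e) (loopless g)) λ ()
    ... | true  | no _ = ≡.refl
    ... | false | _    = ≡.refl

    row-count : ∀ g′ → sum (λ h′ → boolToℕ (compose G H v (combine g′ h′)))
                     ≡ boolToℕ (G g g′) * n + boolToℕ ⌊ g ≟ g′ ⌋ * degree H h
    row-count g′ = begin
      sum (λ h′ → boolToℕ (compose G H v (combine g′ h′)))
        ≡⟨ sum-cong-≗ (λ h′ → ≡.cong boolToℕ (compose-combine G H v g′ h′)) ⟩
      sum (λ h′ → boolToℕ (G g g′ ∨ (⌊ g ≟ g′ ⌋ ∧ H h h′)))
        ≡⟨ count-∨-∧ (G g g′) ⌊ g ≟ g′ ⌋ (H h) (disjoint g′) ⟩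
      boolToℕ (G g g′) * n + boolToℕ ⌊ g ≟ g′ ⌋ * sum (boolToℕ ∘ H h)
        ≡⟨ ≡.cong (λ d → boolToℕ (G g g′) * n + boolToℕ ⌊ g ≟ g′ ⌋ * d) (sumℕ≡sum (boolToℕ ∘ H h)) ⟨
      boolToℕ (G g g′) * n + boolToℕ ⌊ g ≟ g′ ⌋ * degree H h
        ∎

module _ {c ℓ : Level} (Γ : AbelianGroup c ℓ) where
  open AbelianGroup Γ
  open import Algebra.Definitions.RawMonoid rawMonoid using () renaming (_×_ to _·_)
  open import Algebra.Properties.Monoid.Mult monoid using (×-homo-+)
  open import Relation.Binary.Reasoning.Setoid (AbelianGroup.setoid Γ)

  weight-const : ∀ {n} (A : Adj n) a v → weight Γ A (λ _ → a) v ≈ degree A v · a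
  weight-const {zero}  A a v = refl
  weight-const {suc n} = weight-const⁺
    where
    -- The tail of the row of v is the row of zero in λ _ u → A v (suc u), so the
    -- recursion needs a vertex zero to exist.
    weight-const⁺ : ∀ {n} (A : Adj (suc n)) a v → weight Γ A (λ _ → a) v ≈ degree A v · a
    weight-const⁺ {zero} A a v with A v zero
    ... | true  = refl
    ... | false = identityˡ ε
    weight-const⁺ {suc n} A a v with A v zero
    ... | true  = ∙-congˡ (weight-const⁺ (λ _ u → A v (suc u)) a zero)
    ... | false = trans (identityˡ _) (weight-const⁺ (λ _ u → A v (suc u)) a zero)

  compose-isVertexMagicLabeling : ∀ {m n r} (G : Adj m) (H : Adj n) →
    (∀ g → G g g ≡ false) → IsRegular H r →
    ∀ {a} → ¬ a ≈ ε → n · a ≈ ε → IsVertexMagicLabeling Γ (compose {m} {n} G H) (λ _ → a)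
  compose-isVertexMagicLabeling {m} {n} {r} G H loopless regular {a} a≉ε n·a≈ε =
    (λ _ → a≉ε) , r · a , magic
    where
    magic : ∀ v → weight Γ (compose G H) (λ _ → a) v ≈ r · a
    magic v = begin
      weight Γ (compose G H) (λ _ → a) v  ≈⟨ weight-const (compose G H) a v ⟩
      degree (compose G H) v · a          ≡⟨ ≡.cong (_· a) degree≡ ⟩
      (degree G g * n + r) · a            ≈⟨ ×-homo-+ a (degree G g * n) r ⟩
      (degree G g * n) · a ∙ r · a        ≈⟨ ∙-congʳ (∣-×≈ε monoid a (n∣m*n (degree G g)) n·a≈ε) ⟩
      ε ∙ r · a                           ≈⟨ identityˡ (r · a) ⟩
      r · a                               ∎
      where
      g : Fin m
      g = proj₁ (remQuot {m} n v)
      h : Fin n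
      h = proj₂ (remQuot {m} n v)
      degree≡ : degree (compose G H) v ≡ degree G g * n + r
      degree≡ = ≡.trans (degree-compose G H loopless v) (≡.cong (degree G g * n +_) (regular h))

module FiniteAbelianGroup {c ℓ : Level} (Γ : AbelianGroup c ℓ) {N : ℕ}
                          (B : Bijection (setoid (Fin N)) (AbelianGroup.setoid Γ)) where
  open AbelianGroup Γ
  open import Algebra.Definitions.RawMonoid rawMonoid using () renaming (_×_ to _·_)
  open import Algebra.Properties.Group group using (\\-leftDividesˡ; \\-leftDividesʳ; identityˡ-unique)
  open import Algebra.Properties.CommutativeMonoid.Sum commutativeMonoid
    using (sum; sum-permute; sum-cong-≋; ∑-distrib-+; sum-replicate)
  open import Relation.Binary.Reasoning.Setoid (AbelianGroup.setoid Γ)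
  open Inverse (Bijection⇒Inverse B) using (to; from; strictlyInverseˡ)
  open Bijection B using () renaming (injective to to-injective)

  infix 4 _≈?_
  _≈?_ : Decidable _≈_
  _≈?_ = via-injection (Inverse⇒Injection (Symmetry.inverse (Bijection⇒Inverse B))) _≟_

  ∃≉ε : 1 < N → ∃ λ x → ¬ x ≈ ε
  ∃≉ε (s≤s (s≤s z≤n)) with to zero ≈? ε
  ... | no  to0≉ε = to zero , to0≉ε
  ... | yes to0≈ε = to (suc zero) , λ to1≈ε → contradiction (to-injective (trans to0≈ε (sym to1≈ε))) λ ()

  translation : Carrier → Permutation′ N
  translation x = permutation (λ i → from (x ∙ to i)) (λ i → from (x ⁻¹ ∙ to i)) cancel cancel⁻¹
    where
    cancel : ∀ i → from (x ∙ to (from (x ⁻¹ ∙ to i))) ≡ i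
    cancel i = to-injective (trans (strictlyInverseˡ _)
      (trans (∙-congˡ (strictlyInverseˡ _)) (\\-leftDividesˡ x (to i))))
    cancel⁻¹ : ∀ i → from (x ⁻¹ ∙ to (from (x ∙ to i))) ≡ i
    cancel⁻¹ i = to-injective (trans (strictlyInverseˡ _)
      (trans (∙-congˡ (strictlyInverseˡ _)) (\\-leftDividesʳ x (to i))))

  -- Translating by x permutes Γ, so adding x to each summand of Σ Γ changes nothing.
  card-×≈ε : ∀ x → N · x ≈ ε
  card-×≈ε x = identityˡ-unique (N · x) (sum to) (begin
    N · x ∙ sum to                    ≈⟨ ∙-congʳ (sum-replicate N) ⟨
    sum {N} (λ _ → x) ∙ sum to        ≈⟨ ∑-distrib-+ (λ _ → x) to ⟨
    sum (λ i → x ∙ to i)              ≈⟨ sum-cong-≋ (λ i → strictlyInverseˡ (x ∙ to i)) ⟨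
    sum (λ i → to (from (x ∙ to i)))  ≈⟨ sum-permute to (translation x) ⟨
    sum to                            ∎)

theorem3p8 : ∀ {c ℓ : Level} (m n r p : ℕ) (G : Adj m) (H : Adj n) →
    IsSimpleGraph G → IsSimpleGraph H → IsRegular H r →
    Prime p → p ∣ n →
    (Γ : AbelianGroup c ℓ) →
    Bijection (setoid (Fin (p * p))) (AbelianGroup.setoid Γ) →
    IsVertexMagic Γ (compose {m} {n} G H)
theorem3p8 m n r p G H (_ , G-loopless) _ H-regular p-prime p∣n Γ B =
  let x , x≉ε         = ∃≉ε (ℕ.*-mono-< 1<p 1<p)
      a , a≉ε , p·a≈ε = nontrivial-torsion monoid p (p · x ≈? ε) x≉ε (card-×≈ε x)
  in (λ _ → a) , compose-isVertexMagicLabeling Γ G H G-loopless H-regular a≉ε (∣-×≈ε monoid a p∣n p·a≈ε)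
  where
  open AbelianGroup Γ using (monoid; ε)
  open import Algebra.Definitions.RawMonoid (AbelianGroup.rawMonoid Γ) using () renaming (_×_ to _·_)
  open FiniteAbelianGroup Γ B

  1<p : 1 < p
  1<p = nonTrivial⇒n>1 p {{prime⇒nonTrivial p-prime}}
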